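{- Let $P$ be the Petersen graph. Then ${\rm la}_{3}(P)=3$.
   Context: The Petersen graph is the $3$-regular graph on $10$ vertices whose vertices are the $2$-element subsets of $\{1,\dots,5\}$, two being adjacent iff they are disjoint. A linear $3$-forest is a forest each of whose components is a path of length (number of edges) at most $3$. ${\rm la}_3(G)$ is the least number of linear $3$-forests (subgraphs of $G$) whose edge sets partition $E(G)$. -}

module Defs where

open import Level using (0ℓ)
open import Data.Nat using (ℕ; suc; _≤_; _<_)
open import Data.Fin using (Fin) renaming (_<_ to _<ᶠ_)
open import Data.List using (List; []; _∷_; length; concat)
open import Data.List.Relation.Unary.Any using (Any)
open import Data.List.Membership.Propositional using (_∈_)
open import Data.List.Relation.Unary.All using (All)
open import Data.List.Relation.Unary.Unique.Propositional using (Unique)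
open import Data.Vec using (Vec; lookup)
open import Data.Product using (Σ; _×_; ∃; ∃-syntax; _,_)
open import Data.Sum using (_⊎_)
open import Relation.Binary.PropositionalEquality using (_≡_)
open import Relation.Nullary using (¬_)
open import Data.Unit using (⊤)
open import Data.Empty using (⊥)

record Graph : Set₁ where
  field
    V       : Set
    Adj     : V → V → Set
    sym     : ∀ {u v} → Adj u v → Adj v u
    irrefl  : ∀ {v} → ¬ Adj v v
open Graph public

-- The Petersen graph: vertices are 2-element subsets {a,b} ⊆ {1,…,5},
-- represented with a < b (Fin 5 stands for {1,…,5}); adjacency = disjointness.

record PVertex : Set where
  constructor ⟨_,_∣_⟩
  field
    a  : Fin 5
    b  : Fin 5
    a<b : a <ᶠ b
open PVertex public

Disjoint : PVertex → PVertex → Set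
Disjoint x y = ¬ (a x ≡ a y) × ¬ (a x ≡ b y) × ¬ (b x ≡ a y) × ¬ (b x ≡ b y)

Disjoint-sym : ∀ {x y} → Disjoint x y → Disjoint y x
Disjoint-sym (p , q , r , s) =
  (λ e → p (Relation.Binary.PropositionalEquality.sym e)) ,
  (λ e → r (Relation.Binary.PropositionalEquality.sym e)) ,
  (λ e → q (Relation.Binary.PropositionalEquality.sym e)) ,
  (λ e → s (Relation.Binary.PropositionalEquality.sym e))

Disjoint-irrefl : ∀ {x} → ¬ Disjoint x x
Disjoint-irrefl (p , _) = p Relation.Binary.PropositionalEquality.refl

Petersen : Graph
Petersen = record
  { V = PVertex ; Adj = Disjoint ; sym = λ {x} {y} → Disjoint-sym {x} {y} ; irrefl = λ {x} → Disjoint-irrefl {x} }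

module _ (G : Graph) where

  AdjChain : List (V G) → Set
  AdjChain []            = ⊤
  AdjChain (x ∷ [])      = ⊤
  AdjChain (x ∷ y ∷ xs)  = Adj G x y × AdjChain (y ∷ xs)

  -- a path of length (number of edges) at most k in G, given by its vertex
  -- sequence: nonempty, at most k+1 vertices, all distinct, consecutive ones adjacent
  IsPathOfLength≤ : ℕ → List (V G) → Set
  IsPathOfLength≤ k p = 1 ≤ length p × length p ≤ suc k × Unique p × AdjChain p

  record LinearForest (k : ℕ) : Set where
    field
      components : List (List (V G))
      paths      : All (IsPathOfLength≤ k) components
      disjoint   : Unique (concat components)
  open LinearForest public

Consecutive : ∀ {A : Set} → A → A → List A → Set
Consecutive u v []           = ⊥
Consecutive u v (x ∷ [])     = ⊥
Consecutive u v (x ∷ y ∷ xs) = ((u ≡ x × v ≡ y) ⊎ (u ≡ y × v ≡ x)) ⊎ Consecutive u v (y ∷ xs)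

EdgeIn : ∀ {G : Graph} {k : ℕ} → V G → V G → LinearForest G k → Set
EdgeIn u v F = Any (Consecutive u v) (components F)

-- a decomposition of E(G) into m linear k-forests: every edge of G lies in
-- exactly one of them (each forest is a subgraph of G by construction)
record Decomposition (G : Graph) (k m : ℕ) : Set where
  field
    forests : Vec (LinearForest G k) m
    cover   : ∀ u v → Adj G u v → ∃[ i ] (EdgeIn u v (lookup forests i)
                × (∀ j → EdgeIn u v (lookup forests j) → j ≡ i))

la≡ : ℕ → Graph → ℕ → Set
la≡ k G m = Decomposition G k m × (∀ m' → Decomposition G k m' → m ≤ m')

-- A path with n ≤ k + 1 vertices has n − 1 ≤ k n / (k + 1) edges, so a linear
-- 3-forest of the 10-vertex Petersen graph has at most ⌊30/4⌋ = 7 edges and two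
-- such forests cannot cover its 15 edges. Three suffice, by an explicit partition.
module Submission where

open import Defs hiding (sym)
open import Data.Empty using (⊥-elim)
open import Data.Nat using (ℕ; zero; suc; pred; _+_; _*_; _≤_; z≤n; s≤s; _≤?_)
open import Data.Nat.Properties
  using ( *-suc; *-distribˡ-+; +-mono-≤; +-monoˡ-≤; *-monoʳ-≤; ≤-refl; ≤-trans; ≤-pred; n≤1+n
        ; *-cancelˡ-<; *-cancelʳ-<; module ≤-Reasoning)
open import Data.Fin using (zero; suc; #_)
import Data.Fin.Properties as Fin
open import Data.List using (List; []; _∷_; _++_; length; concat; concatMap; map; filter; cartesianProduct)
open import Data.Nat.ListAction using (sum)
open import Data.List.Properties using (length-++; length-removeAt′)
open import Data.List.Relation.Unary.Any as Any using (Any; here; there; _─_)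
open import Data.List.Relation.Unary.All using (All; []; _∷_; all?)
open import Data.List.Relation.Unary.All.Properties using (all-filter)
open import Data.List.Membership.Propositional using (_∈_)
open import Data.List.Membership.Propositional.Properties using (∈-concat⁺′; ∈-concatMap⁺; ∈-map⁺; ∈-lookup)
open import Data.List.Relation.Binary.Subset.Propositional using (_⊆_)
open import Data.List.Relation.Unary.AllPairs using (_∷_)
import Data.List.Relation.Unary.All as All
open import Data.List.Relation.Unary.Unique.Propositional using (Unique)
open import Data.List.Relation.Unary.Unique.DecPropositional using (unique?)
import Data.List.Relation.Unary.Unique.Propositional.Properties as Unique
open import Data.Vec using (Vec; []; _∷_; lookup; toList)
import Data.Vec.Membership.Propositional.Properties as Vec
open import Data.Vec.Membership.Propositional.Properties using (∈-toList⁺)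
open import Data.Product using (∃-syntax; _×_; _,_; uncurry)
open import Data.Sum using (inj₁; inj₂)
open import Data.Unit using (tt)
open import Function using (_∘_)
open import Relation.Binary.Definitions using (DecidableEquality; Decidable)
open import Relation.Binary.PropositionalEquality using (_≡_; _≢_; refl; sym; cong; cong₂; module ≡-Reasoning)
open import Relation.Nullary using (Dec; yes; no; ¬?)
open import Relation.Nullary.Decidable using (True; toWitness; from-yes; _×-dec_; _⊎-dec_; _→-dec_)

module _ {A : Set} where

  ∈-─ : ∀ {x y} {ys : List A} (x∈ys : x ∈ ys) → y ∈ ys → x ≢ y → y ∈ (ys ─ x∈ys)
  ∈-─ (here refl)  (here refl)  x≢y = ⊥-elim (x≢y refl)
  ∈-─ (here _)     (there y∈ys) _   = y∈ys
  ∈-─ (there _)    (here refl)  _   = here refl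
  ∈-─ (there x∈ys) (there y∈ys) x≢y = there (∈-─ x∈ys y∈ys x≢y)

  unique-⊆⇒length≤ : ∀ {xs ys : List A} → Unique xs → xs ⊆ ys → length xs ≤ length ys
  unique-⊆⇒length≤ {[]}     _             _    = z≤n
  unique-⊆⇒length≤ {x ∷ xs} {ys} (x∉xs ∷ u) x∷xs⊆ys = begin
    suc (length xs)               ≤⟨ s≤s (unique-⊆⇒length≤ u xs⊆ys─x) ⟩
    suc (length (ys ─ x∈ys))      ≡⟨ sym (length-removeAt′ ys (Any.index x∈ys)) ⟩
    length ys                     ∎
    where
    open ≤-Reasoning
    x∈ys : x ∈ ys
    x∈ys = x∷xs⊆ys (here refl)
    xs⊆ys─x : xs ⊆ (ys ─ x∈ys)
    xs⊆ys─x y∈xs = ∈-─ x∈ys (x∷xs⊆ys (there y∈xs)) (All.lookup x∉xs y∈xs)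

  consecutive? : DecidableEquality A → ∀ u v (p : List A) → Dec (Consecutive u v p)
  consecutive? _≟_ u v []           = no λ ()
  consecutive? _≟_ u v (x ∷ [])     = no λ ()
  consecutive? _≟_ u v (x ∷ y ∷ xs) =
    ((u ≟ x ×-dec v ≟ y) ⊎-dec (u ≟ y ×-dec v ≟ x)) ⊎-dec consecutive? _≟_ u v (y ∷ xs)

  -- Both orientations of each edge are listed, matching the symmetric Consecutive.
  pathArcs : List A → List (A × A)
  pathArcs []           = []
  pathArcs (x ∷ [])     = []
  pathArcs (x ∷ y ∷ xs) = (x , y) ∷ (y , x) ∷ pathArcs (y ∷ xs)

  forestArcs : List (List A) → List (A × A)
  forestArcs = concatMap pathArcs

  edgeCount : List (List A) → ℕ
  edgeCount ps = sum (map (pred ∘ length) ps)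

  ∈-pathArcs : ∀ {u v} (p : List A) → Consecutive u v p → (u , v) ∈ pathArcs p
  ∈-pathArcs (x ∷ y ∷ xs) (inj₁ (inj₁ (refl , refl))) = here refl
  ∈-pathArcs (x ∷ y ∷ xs) (inj₁ (inj₂ (refl , refl))) = there (here refl)
  ∈-pathArcs (x ∷ y ∷ xs) (inj₂ uv∈y∷xs)              = there (there (∈-pathArcs (y ∷ xs) uv∈y∷xs))

  length-pathArcs : (p : List A) → length (pathArcs p) ≡ 2 * pred (length p)
  length-pathArcs []           = refl
  length-pathArcs (x ∷ [])     = refl
  length-pathArcs (x ∷ y ∷ xs) = begin
    suc (suc (length (pathArcs (y ∷ xs)))) ≡⟨ cong (2 +_) (length-pathArcs (y ∷ xs)) ⟩
    suc (suc (2 * length xs))              ≡⟨ sym (*-suc 2 (length xs)) ⟩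
    2 * suc (length xs)                    ∎
    where open ≡-Reasoning

  length-forestArcs : (ps : List (List A)) → length (forestArcs ps) ≡ 2 * edgeCount ps
  length-forestArcs []       = refl
  length-forestArcs (p ∷ ps) = begin
    length (pathArcs p ++ forestArcs ps)         ≡⟨ length-++ (pathArcs p) ⟩
    length (pathArcs p) + length (forestArcs ps) ≡⟨ cong₂ _+_ (length-pathArcs p) (length-forestArcs ps) ⟩
    2 * pred (length p) + 2 * edgeCount ps       ≡⟨ sym (*-distribˡ-+ 2 (pred (length p)) (edgeCount ps)) ⟩
    2 * edgeCount (p ∷ ps)                       ∎
    where open ≡-Reasoning

pathEdges≤ : ∀ k n → n ≤ suc k → suc k * pred n ≤ k * n
pathEdges≤ k zero    _         = ≤-refl
pathEdges≤ k (suc n) (s≤s n≤k) = begin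
  n + k * n ≤⟨ +-monoˡ-≤ (k * n) n≤k ⟩
  k + k * n ≡⟨ sym (*-suc k n) ⟩
  k * suc n ∎
  where open ≤-Reasoning

UniquelyCovered : ∀ {G k m} → Vec (LinearForest G k) m → V G → V G → Set
UniquelyCovered Fs u v = ∃[ i ] (EdgeIn u v (lookup Fs i) × (∀ j → EdgeIn u v (lookup Fs j) → j ≡ i))

module _ {G : Graph} {k : ℕ} where

  forestEdges≤ : (ps : List (List (V G))) → All (IsPathOfLength≤ G k) ps →
                 suc k * edgeCount ps ≤ k * length (concat ps)
  forestEdges≤ []       []                          = ≤-refl
  forestEdges≤ (p ∷ ps) ((_ , p≤1+k , _) ∷ arePaths) = begin
    suc k * (pred (length p) + edgeCount ps)        ≡⟨ *-distribˡ-+ (suc k) (pred (length p)) (edgeCount ps) ⟩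
    suc k * pred (length p) + suc k * edgeCount ps  ≤⟨ +-mono-≤ (pathEdges≤ k (length p) p≤1+k) (forestEdges≤ ps arePaths) ⟩
    k * length p + k * length (concat ps)           ≡⟨ sym (*-distribˡ-+ k (length p) (length (concat ps))) ⟩
    k * (length p + length (concat ps))             ≡⟨ cong (k *_) (sym (length-++ p)) ⟩
    k * length (concat (p ∷ ps))                    ∎
    where open ≤-Reasoning

  linearForest-edges≤ : (vs : List (V G)) → (∀ v → v ∈ vs) → (F : LinearForest G k) →
                        suc k * edgeCount (components F) ≤ k * length vs
  linearForest-edges≤ vs ∈-vs F = ≤-trans (forestEdges≤ (components F) (paths F))
    (*-monoʳ-≤ k (unique-⊆⇒length≤ (disjoint F) (λ {v} _ → ∈-vs v)))

  ∈-forestArcs : ∀ {u v} (F : LinearForest G k) → EdgeIn u v F → (u , v) ∈ forestArcs (components F)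
  ∈-forestArcs F uv∈F = ∈-concatMap⁺ pathArcs (Any.map (λ {p} → ∈-pathArcs p) uv∈F)

  decompositionArcs : ∀ {m} → Vec (LinearForest G k) m → List (V G × V G)
  decompositionArcs Fs = concatMap (λ (F : LinearForest G k) → forestArcs (components F)) (toList Fs)

  length-decompositionArcs≤ : ∀ {m} b (Fs : Vec (LinearForest G k) m) →
                              (∀ (F : LinearForest G k) → edgeCount (components F) ≤ b) →
                              length (decompositionArcs Fs) ≤ m * (2 * b)
  length-decompositionArcs≤ b []       _      = z≤n
  length-decompositionArcs≤ {suc m} b (F ∷ Fs) edges≤ = begin
    length (forestArcs (components F) ++ decompositionArcs Fs)         ≡⟨ length-++ (forestArcs (components F)) ⟩
    length (forestArcs (components F)) + length (decompositionArcs Fs) ≡⟨ cong (_+ _) (length-forestArcs (components F)) ⟩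
    2 * edgeCount (components F) + length (decompositionArcs Fs)
      ≤⟨ +-mono-≤ (*-monoʳ-≤ 2 (edges≤ F)) (length-decompositionArcs≤ b Fs edges≤) ⟩
    2 * b + m * (2 * b)                                                ∎
    where open ≤-Reasoning

  arcs-length≤decompositionArcs : ∀ {m} (D : Decomposition G k m) (arcs : List (V G × V G)) →
                        Unique arcs → All (uncurry (Adj G)) arcs →
                        length arcs ≤ length (decompositionArcs (Decomposition.forests D))
  arcs-length≤decompositionArcs D arcs unique adjacent = unique-⊆⇒length≤ unique arc∈
    where
    Fs = Decomposition.forests D
    arc∈ : arcs ⊆ decompositionArcs Fs
    arc∈ uv∈arcs with i , uv∈Fᵢ , _ ← Decomposition.cover D _ _ (All.lookup adjacent uv∈arcs) =
      ∈-concat⁺′ (∈-forestArcs (lookup Fs i) uv∈Fᵢ) (∈-map⁺ _ (∈-toList⁺ (Vec.∈-lookup i Fs)))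

module DecidableGraph {G : Graph} (_≟_ : DecidableEquality (V G)) (adj? : Decidable (Adj G)) where

  adjChain? : (p : List (V G)) → Dec (AdjChain G p)
  adjChain? []           = yes tt
  adjChain? (x ∷ [])     = yes tt
  adjChain? (x ∷ y ∷ xs) = adj? x y ×-dec adjChain? (y ∷ xs)

  isPath? : ∀ k p → Dec (IsPathOfLength≤ G k p)
  isPath? k p = 1 ≤? length p ×-dec length p ≤? suc k ×-dec unique? _≟_ p ×-dec adjChain? p

  linearForest : ∀ k ps → {True (all? (isPath? k) ps ×-dec unique? _≟_ (concat ps))} → LinearForest G k
  linearForest k ps {valid} with arePaths , disjoint ← toWitness valid =
    record { components = ps ; paths = arePaths ; disjoint = disjoint }

  edgeIn? : ∀ {k} u v (F : LinearForest G k) → Dec (EdgeIn u v F)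
  edgeIn? u v F = Any.any? (consecutive? _≟_ u v) (components F)

  uniquelyCovered? : ∀ {k m} (Fs : Vec (LinearForest G k) m) u v → Dec (UniquelyCovered Fs u v)
  uniquelyCovered? Fs u v = Fin.any? λ i →
    edgeIn? u v (lookup Fs i) ×-dec Fin.all? λ j → edgeIn? u v (lookup Fs j) →-dec j Fin.≟ i

  decomposition : ∀ {k m} (vs : List (V G)) → (∀ v → v ∈ vs) → (Fs : Vec (LinearForest G k) m) →
                  {True (all? (λ u → all? (λ v → adj? u v →-dec uniquelyCovered? Fs u v) vs) vs)} →
                  Decomposition G k m
  decomposition vs ∈-vs Fs {valid} = record
    { forests = Fs
    ; cover   = λ u v → All.lookup (All.lookup (toWitness valid) (∈-vs u)) (∈-vs v)
    }

_≟ᵥ_ : DecidableEquality PVertex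
⟨ a , b ∣ a<b ⟩ ≟ᵥ ⟨ a′ , b′ ∣ a′<b′ ⟩ with a Fin.≟ a′ | b Fin.≟ b′
... | yes refl | yes refl = yes (cong ⟨ a , b ∣_⟩ (Fin.<-irrelevant a<b a′<b′))
... | no a≢a′  | _        = no (a≢a′ ∘ cong PVertex.a)
... | _        | no b≢b′  = no (b≢b′ ∘ cong PVertex.b)

disjoint? : Decidable Disjoint
disjoint? x y = ¬? (a x Fin.≟ a y) ×-dec ¬? (a x Fin.≟ b y) ×-dec ¬? (b x Fin.≟ a y) ×-dec ¬? (b x Fin.≟ b y)

open DecidableGraph {Petersen} _≟ᵥ_ disjoint?

-- vᵢⱼ is the pair {i, j} ⊆ {1, …, 5}.
v12 v13 v14 v15 v23 v24 v25 v34 v35 v45 : PVertex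
v12 = ⟨ # 0 , # 1 ∣ s≤s z≤n ⟩
v13 = ⟨ # 0 , # 2 ∣ s≤s z≤n ⟩
v14 = ⟨ # 0 , # 3 ∣ s≤s z≤n ⟩
v15 = ⟨ # 0 , # 4 ∣ s≤s z≤n ⟩
v23 = ⟨ # 1 , # 2 ∣ s≤s (s≤s z≤n) ⟩
v24 = ⟨ # 1 , # 3 ∣ s≤s (s≤s z≤n) ⟩
v25 = ⟨ # 1 , # 4 ∣ s≤s (s≤s z≤n) ⟩
v34 = ⟨ # 2 , # 3 ∣ s≤s (s≤s (s≤s z≤n)) ⟩
v35 = ⟨ # 2 , # 4 ∣ s≤s (s≤s (s≤s z≤n)) ⟩
v45 = ⟨ # 3 , # 4 ∣ s≤s (s≤s (s≤s (s≤s z≤n))) ⟩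

petersenVertices : List PVertex
petersenVertices = v12 ∷ v13 ∷ v14 ∷ v15 ∷ v23 ∷ v24 ∷ v25 ∷ v34 ∷ v35 ∷ v45 ∷ []

∈-petersenVertices : ∀ v → v ∈ petersenVertices
∈-petersenVertices ⟨ _ , zero ∣ () ⟩
∈-petersenVertices ⟨ zero , suc zero ∣ s≤s z≤n ⟩ = ∈-lookup (# 0)
∈-petersenVertices ⟨ zero , suc (suc zero) ∣ s≤s z≤n ⟩ = ∈-lookup (# 1)
∈-petersenVertices ⟨ zero , suc (suc (suc zero)) ∣ s≤s z≤n ⟩ = ∈-lookup (# 2)
∈-petersenVertices ⟨ zero , suc (suc (suc (suc zero))) ∣ s≤s z≤n ⟩ = ∈-lookup (# 3)
∈-petersenVertices ⟨ suc _ , suc zero ∣ s≤s () ⟩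
∈-petersenVertices ⟨ suc zero , suc (suc zero) ∣ s≤s (s≤s z≤n) ⟩ = ∈-lookup (# 4)
∈-petersenVertices ⟨ suc zero , suc (suc (suc zero)) ∣ s≤s (s≤s z≤n) ⟩ = ∈-lookup (# 5)
∈-petersenVertices ⟨ suc zero , suc (suc (suc (suc zero))) ∣ s≤s (s≤s z≤n) ⟩ = ∈-lookup (# 6)
∈-petersenVertices ⟨ suc (suc _) , suc (suc zero) ∣ s≤s (s≤s ()) ⟩
∈-petersenVertices ⟨ suc (suc zero) , suc (suc (suc zero)) ∣ s≤s (s≤s (s≤s z≤n)) ⟩ = ∈-lookup (# 7)
∈-petersenVertices ⟨ suc (suc zero) , suc (suc (suc (suc zero))) ∣ s≤s (s≤s (s≤s z≤n)) ⟩ = ∈-lookup (# 8)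
∈-petersenVertices ⟨ suc (suc (suc _)) , suc (suc (suc zero)) ∣ s≤s (s≤s (s≤s ())) ⟩
∈-petersenVertices ⟨ suc (suc (suc zero)) , suc (suc (suc (suc zero))) ∣ s≤s (s≤s (s≤s (s≤s z≤n))) ⟩ = ∈-lookup (# 9)
∈-petersenVertices ⟨ suc (suc (suc (suc _))) , suc (suc (suc (suc zero))) ∣ s≤s (s≤s (s≤s (s≤s ()))) ⟩

petersenDecomposition : Decomposition Petersen 3 3
petersenDecomposition = decomposition petersenVertices ∈-petersenVertices
  ( linearForest 3 ((v12 ∷ v35 ∷ v24 ∷ []) ∷ (v13 ∷ v25 ∷ v14 ∷ []) ∷ (v15 ∷ v23 ∷ []) ∷ [])
  ∷ linearForest 3 ((v12 ∷ v45 ∷ v13 ∷ []) ∷ (v25 ∷ v34 ∷ v15 ∷ v24 ∷ []) ∷ [])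
  ∷ linearForest 3 ((v12 ∷ v34 ∷ []) ∷ (v13 ∷ v24 ∷ []) ∷ (v35 ∷ v14 ∷ v23 ∷ v45 ∷ []) ∷ [])
  ∷ [])

petersenVertices-unique : Unique petersenVertices
petersenVertices-unique = from-yes (unique? _≟ᵥ_ petersenVertices)

disjointPair? : (uv : PVertex × PVertex) → Dec (uncurry Disjoint uv)
disjointPair? (u , v) = disjoint? u v

petersenArcs : List (PVertex × PVertex)
petersenArcs = filter disjointPair? (cartesianProduct petersenVertices petersenVertices)

petersen-forestEdges≤7 : (F : LinearForest Petersen 3) → edgeCount (components F) ≤ 7
petersen-forestEdges≤7 F = ≤-pred (*-cancelˡ-< 4 _ 8 (s≤s (≤-trans edges≤ (n≤1+n 30))))
  where
  edges≤ : 4 * edgeCount (components F) ≤ 30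
  edges≤ = linearForest-edges≤ petersenVertices ∈-petersenVertices F

petersen-decomposition≥3 : ∀ m → Decomposition Petersen 3 m → 3 ≤ m
petersen-decomposition≥3 m D = *-cancelʳ-< 14 2 m (≤-trans (n≤1+n 29) arcs≤)
  where
  -- length petersenArcs evaluates to 30: the 15 edges in both orientations.
  arcs≤ : length petersenArcs ≤ m * 14
  arcs≤ = ≤-trans
    (arcs-length≤decompositionArcs D petersenArcs
      (Unique.filter⁺ disjointPair? (Unique.cartesianProduct⁺ petersenVertices-unique petersenVertices-unique))
      (all-filter disjointPair? (cartesianProduct petersenVertices petersenVertices)))
    (length-decompositionArcs≤ 7 (Decomposition.forests D) petersen-forestEdges≤7)

lemma3p6 : la≡ 3 Petersen 3
lemma3p6 = petersenDecomposition , petersen-decomposition≥3
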